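{- Let $d\geq 2$ be an integer. Then: (i) for every simple planar quadrangulated graph $G$ with $n$ vertices and every $d$-independent set $I$ of $G$, $|I|\leq \frac{2}{d}(n-2)$; (ii) for arbitrarily large $n$ there exists a simple planar quadrangulated graph with $n$ vertices that has a $d$-independent set of size exactly $\frac{2}{d}(n-2)$. That is, the $d$-independence number of simple planar quadrangulated graphs is exactly $\frac{2}{d}(n-2)$.
   Context: Throughout, graphs are connected with $n\geq 3$ vertices. A $d$-independent set of a graph $G$ is an independent set $I$ such that every vertex of $I$ has degree at least $d$ in $G$. A graph is quadrangulated if it has a planar drawing in which every face is bounded by a $4$-cycle. -}

module Defs where

open import Data.Nat using (ℕ; zero; suc; _+_; _*_; _∸_; _≤_; _/_)
open import Data.Bool using (Bool; true; false; if_then_else_)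
open import Data.Fin using (Fin)
open import Data.Fin.Subset using (Subset; _∈_; ∣_∣)
open import Data.List using (List; map; allFin)
open import Data.Nat.ListAction using (sum)
open import Data.Product using (_×_; ∃)
open import Relation.Binary.PropositionalEquality using (_≡_; _≢_)

record SimpleGraph (n : ℕ) : Set where
  field
    adj     : Fin n → Fin n → Bool
    adj-sym : ∀ u v → adj u v ≡ adj v u
    irrefl  : ∀ v → adj v v ≡ false

module _ {n : ℕ} (G : SimpleGraph n) where
  open SimpleGraph G

  Adj : Fin n → Fin n → Set
  Adj u v = adj u v ≡ true

  degree : Fin n → ℕ
  degree v = sum (map (λ u → if adj v u then 1 else 0) (allFin n))

  numDarts : ℕ
  numDarts = sum (map degree (allFin n))

  numEdges : ℕ
  numEdges = numDarts / 2

  data Reach : Fin n → Fin n → Set where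
    here : ∀ {u} → Reach u u
    step : ∀ {u v w} → Adj u v → Reach v w → Reach u w

  Connected : Set
  Connected = ∀ u v → Reach u v

  IsIndependent : Subset n → Set
  IsIndependent I = ∀ u v → u ∈ I → v ∈ I → adj u v ≡ false

  IsDIndependent : ℕ → Subset n → Set
  IsDIndependent d I = IsIndependent I × (∀ v → v ∈ I → d ≤ degree v)

iter : {A : Set} → (A → A) → ℕ → A → A
iter f zero x = x
iter f (suc k) x = f (iter f k x)

Distinct4 : {A : Set} → A → A → A → A → Set
Distinct4 a b c d =
  a ≢ b × a ≢ c × a ≢ d × b ≢ c × b ≢ d × c ≢ d

-- A combinatorial (rotation-system) embedding of G in the sphere in which
-- every face is bounded by a 4-cycle.
--   rot v : cyclic permutation of the neighbourhood N(v) (the rotation at v).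
--   Faces are the orbits of the dart map  (u , v) ↦ (v , rot v u).
--   face-4 : every face orbit closes after exactly 4 darts and visits
--            4 distinct vertices, i.e. is bounded by a 4-cycle.
--   euler  : genus 0, i.e. V − E + F = 2, where F = numDarts / 4 is the number
--            of faces (each face orbit contains exactly 4 darts by face-4).
record QuadEmbedding {n : ℕ} (G : SimpleGraph n) : Set where
  field
    rot     : Fin n → Fin n → Fin n
    rot-adj : ∀ v u → Adj G v u → Adj G v (rot v u)
    rot-inj : ∀ v u w → Adj G v u → Adj G v w → rot v u ≡ rot v w → u ≡ w
    rot-cyc : ∀ v u w → Adj G v u → Adj G v w → ∃ λ k → iter (rot v) k u ≡ w
    face-4  : ∀ u v → Adj G u v →
              rot (rot (rot v u) v) (rot v u) ≡ u
              × rot u (rot (rot v u) v) ≡ v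
              × Distinct4 u v (rot v u) (rot (rot v u) v)
    euler   : n + numDarts G / 4 ≡ numEdges G + 2

-- simple planar quadrangulated graph (connected, as in the standing assumptions)
PlanarQuadrangulated : {n : ℕ} → SimpleGraph n → Set
PlanarQuadrangulated G = Connected G × QuadEmbedding G

{-# OPTIONS --safe #-}
-- Every edge has at most one end in an independent set I, so summing the degrees of the
-- vertices of I counts distinct edges: d·|I| ≤ Σ_{v∈I} deg v ≤ |E|.  In a quadrangulation
-- each face is bounded by four of the 2|E| darts, so 2|F| = |E|, and Euler's formula
-- n + |F| = |E| + 2 turns this into |E| = 2(n − 2).
-- Both inequalities are equalities for t copies of K₂,d glued along two vertices A, B of
-- their d-sides: the 2t vertices of the 2-sides have degree d, every edge has exactly one
-- end among them, and n = 2 + t·d is arbitrarily large.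

module Submission where

open import Defs
open import Data.Nat using (ℕ; zero; suc; _+_; _*_; _∸_; _≤_; _/_; z≤n; s≤s)
open import Data.Nat.Properties hiding (_≟_)
open import Data.Nat.DivMod using (m*n/n≡m; /-monoˡ-≤; m/n/o≡m/[n*o]; m/n*n≤m)
open import Data.Nat.Tactic.RingSolver using (solve-∀)
open import Data.Bool using (Bool; true; false; if_then_else_)
open import Data.Fin using (Fin; zero; suc; toℕ; fromℕ; inject₁; _↑ˡ_; _↑ʳ_; combine; remQuot; _≟_)
open import Data.Fin.Properties as Fin using (toℕ-inject₁; toℕ-fromℕ; toℕ<n; remQuot-combine; combine-remQuot)
open import Data.Fin.Subset using (Subset; _∈_; ∣_∣)
open import Data.List using (allFin; map; tabulate)
open import Data.List.Properties using (map-tabulate)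
open import Data.Nat.ListAction using () renaming (sum to sumᴸ)
open import Data.Vec as Vec using (lookup; _∷_; [])
open import Data.Vec.Properties using (lookup⇒[]=; []=⇒lookup; lookup∘tabulate)
open import Data.Product using (_×_; ∃; Σ; _,_; uncurry)
open import Function using (_∘_; id; _↔_; Inverse; mk↔ₛ′; mk⇔)
open import Relation.Binary.PropositionalEquality
open import Relation.Nullary using (does; yes; no; contradiction)
open import Relation.Nullary.Decidable using (dec-true)
open import Data.Bool.Properties using (⇔→≡)
open import Algebra.Properties.Semiring.Sum +-*-semiring
  using (sum-syntax; ∑-comm; ∑-distrib-+; *-distribˡ-sum; sum-cong-≗)

𝟙 : Bool → ℕ
𝟙 b = if b then 1 else 0

∑-mono-≤ : ∀ {n} {f g : Fin n → ℕ} → (∀ i → f i ≤ g i) → ∑[ i < n ] f i ≤ ∑[ i < n ] g i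
∑-mono-≤ {zero} _ = z≤n
∑-mono-≤ {suc n} f≤g = +-mono-≤ (f≤g zero) (∑-mono-≤ (f≤g ∘ suc))

∑-const : ∀ n c → ∑[ i < n ] c ≡ n * c
∑-const zero c = refl
∑-const (suc n) c = cong (c +_) (∑-const n c)

∑-δ : ∀ {n} (i : Fin n) → ∑[ j < n ] 𝟙 (does (i ≟ j)) ≡ 1
∑-δ {suc n} zero = cong suc (trans (∑-const n 0) (*-zeroʳ n))
∑-δ {suc n} (suc i) = ∑-δ i

∑-+ : ∀ m {k} (f : Fin (m + k) → ℕ) →
      ∑[ i < m + k ] f i ≡ ∑[ i < m ] f (i ↑ˡ k) + ∑[ i < k ] f (m ↑ʳ i)
∑-+ zero f = refl
∑-+ (suc m) f = trans (cong (f zero +_) (∑-+ m (f ∘ suc))) (sym (+-assoc (f zero) _ _))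

∑-* : ∀ m {k} (f : Fin (m * k) → ℕ) → ∑[ i < m * k ] f i ≡ ∑[ i < m ] ∑[ j < k ] f (combine i j)
∑-* zero f = refl
∑-* (suc m) {k} f = trans (∑-+ k f) (cong (∑[ j < k ] f (j ↑ˡ (m * k)) +_) (∑-* m (f ∘ (k ↑ʳ_))))

sumᴸ-allFin : ∀ {n} (f : Fin n → ℕ) → sumᴸ (map f (allFin n)) ≡ ∑[ i < n ] f i
sumᴸ-allFin f = trans (cong sumᴸ (map-tabulate id f)) (sumᴸ-tabulate f)
  where
  sumᴸ-tabulate : ∀ {n} (f : Fin n → ℕ) → sumᴸ (tabulate f) ≡ ∑[ i < n ] f i
  sumᴸ-tabulate {zero} f = refl
  sumᴸ-tabulate {suc n} f = cong (f zero +_) (sumᴸ-tabulate (f ∘ suc))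

χ : ∀ {n} → Subset n → Fin n → ℕ
χ p i = 𝟙 (lookup p i)

∣p∣≡∑χ : ∀ {n} (p : Subset n) → ∣ p ∣ ≡ ∑[ i < n ] χ p i
∣p∣≡∑χ [] = refl
∣p∣≡∑χ (true ∷ p) = cong suc (∣p∣≡∑χ p)
∣p∣≡∑χ (false ∷ p) = ∣p∣≡∑χ p

at-most-one-end : ∀ a b c → (b ≡ true → c ≡ true → a ≡ false) → (𝟙 b + 𝟙 c) * 𝟙 a ≤ 𝟙 a
at-most-one-end false b c _ = ≤-reflexive (*-zeroʳ (𝟙 b + 𝟙 c))
at-most-one-end true false false _ = z≤n
at-most-one-end true false true _ = ≤-refl
at-most-one-end true true false _ = ≤-refl
at-most-one-end true true true indep = contradiction (indep refl refl) λ ()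

exactly-one-end : ∀ a b c → (a ≡ true → 𝟙 b + 𝟙 c ≡ 1) → (𝟙 b + 𝟙 c) * 𝟙 a ≡ 𝟙 a
exactly-one-end false b c _ = *-zeroʳ (𝟙 b + 𝟙 c)
exactly-one-end true b c one = trans (*-identityʳ _) (one refl)

module _ {n : ℕ} (G : SimpleGraph n) where
  open SimpleGraph G

  IsBipartitionSide : Subset n → Set
  IsBipartitionSide I = ∀ u v → Adj G u v → χ I u + χ I v ≡ 1

  bipartitionSide⇒independent : ∀ {I} → IsBipartitionSide I → IsIndependent G I
  bipartitionSide⇒independent {I} side u v u∈I v∈I with adj u v in uv
  ... | false = refl
  ... | true = contradiction (trans (sym (cong₂ (λ a b → 𝟙 a + 𝟙 b) ([]=⇒lookup u∈I) ([]=⇒lookup v∈I)))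
                                    (side u v uv)) λ ()

  degree≡∑ : ∀ v → degree G v ≡ ∑[ u < n ] 𝟙 (adj v u)
  degree≡∑ v = sumᴸ-allFin (λ u → 𝟙 (adj v u))

  numDarts≡∑∑ : numDarts G ≡ ∑[ v < n ] ∑[ u < n ] 𝟙 (adj v u)
  numDarts≡∑∑ = trans (sumᴸ-allFin (degree G)) (sum-cong-≗ degree≡∑)

  degreeSum : Subset n → ℕ
  degreeSum I = ∑[ v < n ] (χ I v * degree G v)

  private
    d*∣I∣≡∑ : ∀ d I → d * ∣ I ∣ ≡ ∑[ v < n ] (χ I v * d)
    d*∣I∣≡∑ d I = begin
      d * ∣ I ∣                ≡⟨ cong (d *_) (∣p∣≡∑χ I) ⟩
      d * (∑[ v < n ] χ I v)   ≡⟨ *-distribˡ-sum d (χ I) ⟩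
      ∑[ v < n ] (d * χ I v)   ≡⟨ sum-cong-≗ (λ v → *-comm d (χ I v)) ⟩
      ∑[ v < n ] (χ I v * d)   ∎
      where open ≡-Reasoning

  minDegree⇒d*∣I∣≤degreeSum : ∀ {d I} → (∀ v → v ∈ I → d ≤ degree G v) → d * ∣ I ∣ ≤ degreeSum I
  minDegree⇒d*∣I∣≤degreeSum {d} {I} d≤deg = ≤-trans (≤-reflexive (d*∣I∣≡∑ d I)) (∑-mono-≤ pointwise)
    where
    pointwise : ∀ v → χ I v * d ≤ χ I v * degree G v
    pointwise v with lookup I v in v∈I
    ... | true = *-monoʳ-≤ 1 (d≤deg v (lookup⇒[]= v I v∈I))
    ... | false = z≤n

  regular⇒d*∣I∣≡degreeSum : ∀ {d I} → (∀ v → v ∈ I → degree G v ≡ d) → d * ∣ I ∣ ≡ degreeSum I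
  regular⇒d*∣I∣≡degreeSum {d} {I} deg≡d = trans (d*∣I∣≡∑ d I) (sum-cong-≗ pointwise)
    where
    pointwise : ∀ v → χ I v * d ≡ χ I v * degree G v
    pointwise v with lookup I v in v∈I
    ... | true = cong (1 *_) (sym (deg≡d v (lookup⇒[]= v I v∈I)))
    ... | false = refl

  -- Each dart is counted once from its tail and once from its head.
  2*degreeSum≡∑∑ : ∀ I → 2 * degreeSum I ≡ ∑[ v < n ] ∑[ u < n ] ((χ I v + χ I u) * 𝟙 (adj v u))
  2*degreeSum≡∑∑ I = begin
    2 * degreeSum I                                 ≡⟨ cong (degreeSum I +_) (+-identityʳ _) ⟩
    degreeSum I + degreeSum I                       ≡⟨ cong₂ _+_ tails heads ⟩
    ∑[ v < n ] ∑out v + ∑[ v < n ] ∑into v          ≡⟨ ∑-distrib-+ ∑out ∑into ⟨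
    ∑[ v < n ] (∑out v + ∑into v)                   ≡⟨ sum-cong-≗ (λ v → ∑-distrib-+ (out v) (into v)) ⟨
    ∑[ v < n ] ∑[ u < n ] (out v u + into v u)      ≡⟨ sum-cong-≗ (λ v → sum-cong-≗ (distrib v)) ⟨
    ∑[ v < n ] ∑[ u < n ] ((χ I v + χ I u) * 𝟙 (adj v u)) ∎
    where
    open ≡-Reasoning
    out into : Fin n → Fin n → ℕ
    out v u = χ I v * 𝟙 (adj v u)
    into v u = χ I u * 𝟙 (adj v u)
    ∑out ∑into : Fin n → ℕ
    ∑out v = ∑[ u < n ] out v u
    ∑into v = ∑[ u < n ] into v u
    distrib : ∀ v u → (χ I v + χ I u) * 𝟙 (adj v u) ≡ out v u + into v u
    distrib v u = *-distribʳ-+ (𝟙 (adj v u)) (χ I v) (χ I u)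
    tails : degreeSum I ≡ ∑[ v < n ] ∑out v
    tails = sum-cong-≗ (λ v → trans (cong (χ I v *_) (degree≡∑ v))
                                    (*-distribˡ-sum (χ I v) (λ u → 𝟙 (adj v u))))
    heads : degreeSum I ≡ ∑[ v < n ] ∑into v
    heads = trans tails (trans (∑-comm out)
      (sum-cong-≗ (λ v → sum-cong-≗ (λ u → cong (λ b → χ I u * 𝟙 b) (adj-sym u v)))))

  independent⇒2*degreeSum≤numDarts : ∀ {I} → IsIndependent G I → 2 * degreeSum I ≤ numDarts G
  independent⇒2*degreeSum≤numDarts {I} indep = begin
    2 * degreeSum I                                         ≡⟨ 2*degreeSum≡∑∑ I ⟩
    ∑[ v < n ] ∑[ u < n ] ((χ I v + χ I u) * 𝟙 (adj v u))   ≤⟨ ∑-mono-≤ (λ v → ∑-mono-≤ (pointwise v)) ⟩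
    ∑[ v < n ] ∑[ u < n ] 𝟙 (adj v u)                       ≡⟨ numDarts≡∑∑ ⟨
    numDarts G                                              ∎
    where
    open ≤-Reasoning
    pointwise : ∀ v u → (χ I v + χ I u) * 𝟙 (adj v u) ≤ 𝟙 (adj v u)
    pointwise v u = at-most-one-end (adj v u) (lookup I v) (lookup I u)
      (λ v∈I u∈I → indep v u (lookup⇒[]= v I v∈I) (lookup⇒[]= u I u∈I))

  bipartitionSide⇒2*degreeSum≡numDarts : ∀ {I} → IsBipartitionSide I → 2 * degreeSum I ≡ numDarts G
  bipartitionSide⇒2*degreeSum≡numDarts {I} side = begin
    2 * degreeSum I                                         ≡⟨ 2*degreeSum≡∑∑ I ⟩
    ∑[ v < n ] ∑[ u < n ] ((χ I v + χ I u) * 𝟙 (adj v u))   ≡⟨ sum-cong-≗ (λ v → sum-cong-≗ (pointwise v)) ⟩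
    ∑[ v < n ] ∑[ u < n ] 𝟙 (adj v u)                       ≡⟨ numDarts≡∑∑ ⟨
    numDarts G                                              ∎
    where
    open ≡-Reasoning
    pointwise : ∀ v u → (χ I v + χ I u) * 𝟙 (adj v u) ≡ 𝟙 (adj v u)
    pointwise v u = exactly-one-end (adj v u) (lookup I v) (lookup I u) (side v u)

  independent⇒degreeSum≤numEdges : ∀ {I} → IsIndependent G I → degreeSum I ≤ numEdges G
  independent⇒degreeSum≤numEdges {I} indep = begin
    degreeSum I            ≡⟨ m*n/n≡m (degreeSum I) 2 ⟨
    degreeSum I * 2 / 2    ≤⟨ /-monoˡ-≤ 2 (≤-trans (≤-reflexive (*-comm (degreeSum I) 2))
                                                   (independent⇒2*degreeSum≤numDarts indep)) ⟩
    numDarts G / 2         ∎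
    where open ≤-Reasoning

  Reach-trans : ∀ {u v w} → Reach G u v → Reach G v w → Reach G u w
  Reach-trans here r = r
  Reach-trans (step a r) r′ = step a (Reach-trans r r′)

  Reach-sym : ∀ {u v} → Reach G u v → Reach G v u
  Reach-sym here = here
  Reach-sym (step {u} {v} a r) = Reach-trans (Reach-sym r) (step (trans (adj-sym v u) a) here)

  connected-if-all-reach : ∀ r → (∀ u → Reach G u r) → Connected G
  connected-if-all-reach r reach u v = Reach-trans (reach u) (Reach-sym (reach v))

-- The upper bound for quadrangulations

euler⇒edges≤2[n∸2] : ∀ {n e f} → n + f ≡ e + 2 → f * 2 ≤ e → e ≤ 2 * (n ∸ 2)
euler⇒edges≤2[n∸2] {n} {e} {f} euler 2f≤e = begin
  e                ≡⟨ m+n∸n≡m e 4 ⟨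
  e + 4 ∸ 4        ≤⟨ ∸-monoˡ-≤ 4 e+4≤2n ⟩
  2 * n ∸ 2 * 2    ≡⟨ *-distribˡ-∸ 2 n 2 ⟨
  2 * (n ∸ 2)      ∎
  where
  open ≤-Reasoning
  rearrange : ∀ x → x + 4 + x ≡ 2 * (x + 2)
  rearrange = solve-∀
  e+4≤2n : e + 4 ≤ 2 * n
  e+4≤2n = +-cancelʳ-≤ e (e + 4) (2 * n) (begin
    e + 4 + e        ≡⟨ rearrange e ⟩
    2 * (e + 2)      ≡⟨ cong (2 *_) euler ⟨
    2 * (n + f)      ≡⟨ *-distribˡ-+ 2 n f ⟩
    2 * n + 2 * f    ≤⟨ +-monoʳ-≤ (2 * n) (≤-trans (≤-reflexive (*-comm 2 f)) 2f≤e) ⟩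
    2 * n + e        ∎)

quadrangulation⇒numEdges≤2[n∸2] : ∀ {n} {G : SimpleGraph n} → QuadEmbedding G → numEdges G ≤ 2 * (n ∸ 2)
quadrangulation⇒numEdges≤2[n∸2] {n} {G} Q = euler⇒edges≤2[n∸2] {n} (QuadEmbedding.euler Q) 2F≤E
  where
  -- F = D / 4 = (D / 2) / 2 = E / 2
  2F≤E : numDarts G / 4 * 2 ≤ numEdges G
  2F≤E = subst (λ F → F * 2 ≤ numEdges G) (m/n/o≡m/[n*o] (numDarts G) 2 2) (m/n*n≤m (numEdges G) 2)

quadrangulation⇒d*∣I∣≤2[n∸2] : ∀ {n d} {G : SimpleGraph n} {I} →
  QuadEmbedding G → IsDIndependent G d I → d * ∣ I ∣ ≤ 2 * (n ∸ 2)
quadrangulation⇒d*∣I∣≤2[n∸2] {G = G} Q (indep , d≤deg) = begin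
  _ ≤⟨ minDegree⇒d*∣I∣≤degreeSum G d≤deg ⟩
  _ ≤⟨ independent⇒degreeSum≤numEdges G indep ⟩
  _ ≤⟨ quadrangulation⇒numEdges≤2[n∸2] Q ⟩
  _ ∎
  where open ≤-Reasoning

module _ {A : Set} where

  Cyclic : (A → A) → Set
  Cyclic f = ∀ x y → ∃ λ k → iter f k x ≡ y

  iter-suc : ∀ (f : A → A) k x → iter f (suc k) x ≡ iter f k (f x)
  iter-suc f zero x = refl
  iter-suc f (suc k) x = cong f (iter-suc f k x)

  iter-+ : ∀ (f : A → A) k l x → iter f (k + l) x ≡ iter f k (iter f l x)
  iter-+ f zero l x = refl
  iter-+ f (suc k) l x = cong f (iter-+ f k l x)

  iter-twice : ∀ (f : A → A) k x → iter (f ∘ f) k x ≡ iter f (k * 2) x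
  iter-twice f zero x = refl
  iter-twice f (suc k) x = cong (f ∘ f) (iter-twice f k x)

  iter-inverse : ∀ {f g : A → A} → (∀ x → g (f x) ≡ x) → ∀ k x → iter g k (iter f k x) ≡ x
  iter-inverse g∘f zero x = refl
  iter-inverse {g = g} g∘f (suc k) x =
    trans (iter-suc g k _) (trans (cong (iter g k) (g∘f _)) (iter-inverse g∘f k x))

  cyclic-inverse : ∀ {f g : A → A} → (∀ x → g (f x) ≡ x) → Cyclic f → Cyclic g
  cyclic-inverse {g = g} g∘f cyc x y with cyc y x
  ... | k , fᵏy≡x = k , trans (cong (iter g k) (sym fᵏy≡x)) (iter-inverse g∘f k y)

iter-natural : ∀ {A B : Set} {f : A → A} {g : B → B} (h : A → B) →
               (∀ x → h (f x) ≡ g (h x)) → ∀ k x → h (iter f k x) ≡ iter g k (h x)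
iter-natural h comm zero x = refl
iter-natural {f = f} {g} h comm (suc k) x = trans (comm (iter f k x)) (cong g (iter-natural h comm k x))

cyclic-along : ∀ {X Y : Set} {f : X → X} {g : Y → Y} (h : X → Y) → (∀ x → h (f x) ≡ g (h x)) →
               Cyclic f → ∀ x x′ → ∃ λ k → iter g k (h x) ≡ h x′
cyclic-along h comm cyc x x′ with cyc x x′
... | k , x↦x′ = k , trans (sym (iter-natural h comm k x)) (cong h x↦x′)

reach-twice : ∀ {Y : Set} {g : Y → Y} {y y′} → (∃ λ k → iter (g ∘ g) k y ≡ y′) → ∃ λ k → iter g k y ≡ y′
reach-twice {g = g} {y} (k , y↦y′) = k * 2 , trans (sym (iter-twice g k y)) y↦y′

sucUnlessZero : ∀ {m} → Fin (suc m) → Fin (suc (suc m))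
sucUnlessZero zero = zero
sucUnlessZero (suc i) = suc (suc i)

-- the cyclic successor 0 ↦ 1 ↦ ⋯ ↦ m ↦ 0 on Fin (suc m)
next : ∀ {m} → Fin (suc m) → Fin (suc m)
next {zero} zero = zero
next {suc m} zero = suc zero
next {suc m} (suc i) = sucUnlessZero (next i)

prev : ∀ {m} → Fin (suc m) → Fin (suc m)
prev {m} zero = fromℕ m
prev (suc i) = inject₁ i

next-inject₁ : ∀ {m} (i : Fin m) → next (inject₁ i) ≡ suc i
next-inject₁ {suc m} zero = refl
next-inject₁ {suc m} (suc i) = cong sucUnlessZero (next-inject₁ i)

next-fromℕ : ∀ m → next (fromℕ m) ≡ zero
next-fromℕ zero = refl
next-fromℕ (suc m) = cong sucUnlessZero (next-fromℕ m)

next-prev : ∀ {m} (i : Fin (suc m)) → next (prev i) ≡ i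
next-prev {m} zero = next-fromℕ m
next-prev (suc i) = next-inject₁ i

prev-next : ∀ {m} (i : Fin (suc m)) → prev (next i) ≡ i
prev-next {zero} zero = refl
prev-next {suc m} zero = refl
prev-next {suc m} (suc i) with next i | prev-next i
... | zero | prev0≡i = cong suc prev0≡i
... | suc j | prev[sj]≡i = cong suc prev[sj]≡i

next-injective : ∀ {m} {i j : Fin (suc m)} → next i ≡ next j → i ≡ j
next-injective {i = i} {j} eq = trans (sym (prev-next i)) (trans (cong prev eq) (prev-next j))

prev-injective : ∀ {m} {i j : Fin (suc m)} → prev i ≡ prev j → i ≡ j
prev-injective {i = i} {j} eq = trans (sym (next-prev i)) (trans (cong next eq) (next-prev j))

prev≢zero : ∀ {m} (k : Fin (suc (suc m))) → k ≢ suc zero → prev k ≢ zero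
prev≢zero k k≢1 eq = k≢1 (trans (sym (next-prev k)) (cong next eq))

next≢id : ∀ {m} (i : Fin (suc (suc m))) → next i ≢ i
next≢id zero ()
next≢id {zero} (suc zero) ()
next≢id {suc m} (suc i) eq with next i | next≢id i
next≢id {suc m} (suc i) () | zero | _
... | suc j | sj≢i = sj≢i (Fin.suc-injective eq)

iter-next-zero : ∀ {m} k (i : Fin (suc m)) → toℕ i ≡ k → iter next k zero ≡ i
iter-next-zero zero zero _ = refl
iter-next-zero (suc k) (suc i) eq =
  trans (cong next (iter-next-zero k (inject₁ i) (trans (toℕ-inject₁ i) (suc-injective eq)))) (next-inject₁ i)

next-period : ∀ m → iter next (suc m) (zero {m}) ≡ zero
next-period m = trans (cong next (iter-next-zero m (fromℕ m) (toℕ-fromℕ m))) (next-fromℕ m)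

next-reaches-zero : ∀ {m} (i : Fin (suc m)) → iter next (suc m ∸ toℕ i) i ≡ zero
next-reaches-zero {m} i = begin
  iter next c i                        ≡⟨ cong (iter next c) (iter-next-zero (toℕ i) i refl) ⟨
  iter next c (iter next (toℕ i) zero) ≡⟨ iter-+ next c (toℕ i) zero ⟨
  iter next (c + toℕ i) zero           ≡⟨ cong (λ k → iter next k zero) (m∸n+n≡m (<⇒≤ (toℕ<n i))) ⟩
  iter next (suc m) zero               ≡⟨ next-period m ⟩
  zero                                 ∎
  where
  open ≡-Reasoning
  c = suc m ∸ toℕ i

next-cyclic : ∀ {m} → Cyclic (next {m})
next-cyclic {m} i j = toℕ j + (suc m ∸ toℕ i) , (begin
  iter next (toℕ j + (suc m ∸ toℕ i)) i             ≡⟨ iter-+ next (toℕ j) (suc m ∸ toℕ i) i ⟩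
  iter next (toℕ j) (iter next (suc m ∸ toℕ i) i)   ≡⟨ cong (iter next (toℕ j)) (next-reaches-zero i) ⟩
  iter next (toℕ j) zero                            ≡⟨ iter-next-zero (toℕ j) j refl ⟩
  j                                                 ∎)
  where open ≡-Reasoning

prev-cyclic : ∀ {m} → Cyclic (prev {m})
prev-cyclic = cyclic-inverse prev-next next-cyclic

module _ {A : Set} where

  Distinct4-rotate : ∀ {a b c d : A} → Distinct4 a b c d → Distinct4 b c d a
  Distinct4-rotate (a≢b , a≢c , a≢d , b≢c , b≢d , c≢d) = b≢c , b≢d , ≢-sym a≢b , c≢d , ≢-sym a≢c , ≢-sym a≢d

  Distinct4-reflect : ∀ {B : Set} (h : A → B) {a b c d} →
                      Distinct4 (h a) (h b) (h c) (h d) → Distinct4 a b c d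
  Distinct4-reflect h (p , q , r , s , t , u) =
    p ∘ cong h , q ∘ cong h , r ∘ cong h , s ∘ cong h , t ∘ cong h , u ∘ cong h

module _ {X : Set} (rot : X → X → X) where

  IsQuadFace : X → X → Set
  IsQuadFace u v = rot (rot (rot v u) v) (rot v u) ≡ u
                 × rot u (rot (rot v u) v) ≡ v
                 × Distinct4 u v (rot v u) (rot (rot v u) v)

  -- the face through the dart (u , v), traced by (u , v) ↦ (v , rot v u), is the 4-cycle u v w x
  IsSquareFace : X → X → X → X → Set
  IsSquareFace u v w x = rot v u ≡ w × rot w v ≡ x × rot x w ≡ u × rot u x ≡ v × Distinct4 u v w x

  squareFace-rotate : ∀ {u v w x} → IsSquareFace u v w x → IsSquareFace v w x u
  squareFace-rotate (vu , wv , xw , ux , distinct) = wv , xw , ux , vu , Distinct4-rotate distinct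

  quadFace₀ : ∀ {u v w x} → IsSquareFace u v w x → IsQuadFace u v
  quadFace₀ (refl , refl , xw , ux , distinct) = xw , ux , distinct

  quadFace₁ : ∀ {u v w x} → IsSquareFace u v w x → IsQuadFace v w
  quadFace₁ = quadFace₀ ∘ squareFace-rotate

  quadFace₂ : ∀ {u v w x} → IsSquareFace u v w x → IsQuadFace w x
  quadFace₂ = quadFace₁ ∘ squareFace-rotate

  quadFace₃ : ∀ {u v w x} → IsSquareFace u v w x → IsQuadFace x u
  quadFace₃ = quadFace₂ ∘ squareFace-rotate

quadFace-reflect : ∀ {X Y : Set} {rotX : X → X → X} {rotY : Y → Y → Y} (h : X → Y) →
  (∀ {a b} → h a ≡ h b → a ≡ b) → (∀ a b → h (rotX a b) ≡ rotY (h a) (h b)) →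
  ∀ {u v} → IsQuadFace rotY (h u) (h v) → IsQuadFace rotX u v
quadFace-reflect {rotX = rotX} {rotY} h injective hom {u} {v} (x↦u , u↦v , distinct) =
  injective (begin
    h (rotX x w)        ≡⟨ hom x w ⟩
    rotY (h x) (h w)    ≡⟨ cong₂ rotY hx hw ⟩
    _                   ≡⟨ x↦u ⟩
    h u                 ∎) ,
  injective (begin
    h (rotX u x)        ≡⟨ hom u x ⟩
    rotY (h u) (h x)    ≡⟨ cong (rotY (h u)) hx ⟩
    _                   ≡⟨ u↦v ⟩
    h v                 ∎) ,
  Distinct4-reflect h (subst₂ (Distinct4 (h u) (h v)) (sym hw) (sym hx) distinct)
  where
  open ≡-Reasoning
  w = rotX v u
  x = rotX w v
  hw : h w ≡ rotY (h v) (h u)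
  hw = hom v u
  hx : h x ≡ rotY (rotY (h v) (h u)) (h v)
  hx = trans (hom w v) (cong (λ z → rotY z (h v)) hw)

module Pullback {V : Set} {n : ℕ} (vertices : Fin n ↔ V)
                (adjV : V → V → Bool) (adjV-sym : ∀ x y → adjV x y ≡ adjV y x)
                (adjV-irrefl : ∀ x → adjV x x ≡ false) (rotV : V → V → V) where

  open Inverse vertices using (strictlyInverseˡ; strictlyInverseʳ) renaming (to to dec; from to enc)

  graph : SimpleGraph n
  graph = record
    { adj = λ u v → adjV (dec u) (dec v)
    ; adj-sym = λ u v → adjV-sym (dec u) (dec v)
    ; irrefl = λ v → adjV-irrefl (dec v)
    }

  rot : Fin n → Fin n → Fin n
  rot v u = enc (rotV (dec v) (dec u))

  dec-injective : ∀ {u v} → dec u ≡ dec v → u ≡ v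
  dec-injective {u} {v} eq = trans (sym (strictlyInverseʳ u)) (trans (cong enc eq) (strictlyInverseʳ v))

  dec-rot : ∀ v u → dec (rot v u) ≡ rotV (dec v) (dec u)
  dec-rot v u = strictlyInverseˡ _

  rot-adj : (∀ v u → adjV v u ≡ true → adjV v (rotV v u) ≡ true) →
            ∀ v u → Adj graph v u → Adj graph v (rot v u)
  rot-adj rotV-adj v u a = trans (cong (adjV (dec v)) (dec-rot v u)) (rotV-adj (dec v) (dec u) a)

  rot-inj : (∀ v u w → adjV v u ≡ true → adjV v w ≡ true → rotV v u ≡ rotV v w → u ≡ w) →
            ∀ v u w → Adj graph v u → Adj graph v w → rot v u ≡ rot v w → u ≡ w
  rot-inj rotV-inj v u w au aw eq =
    dec-injective (rotV-inj (dec v) (dec u) (dec w) au aw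
                            (trans (sym (dec-rot v u)) (trans (cong dec eq) (dec-rot v w))))

  rot-cyc : (∀ v u w → adjV v u ≡ true → adjV v w ≡ true → ∃ λ k → iter (rotV v) k u ≡ w) →
            ∀ v u w → Adj graph v u → Adj graph v w → ∃ λ k → iter (rot v) k u ≡ w
  rot-cyc rotV-cyc v u w au aw with rotV-cyc (dec v) (dec u) (dec w) au aw
  ... | k , u↦w = k , dec-injective (begin
    dec (iter (rot v) k u)             ≡⟨ iter-natural dec (dec-rot v) k u ⟩
    iter (rotV (dec v)) k (dec u)      ≡⟨ u↦w ⟩
    dec w                              ∎)
    where open ≡-Reasoning

  face-4 : (∀ u v → adjV u v ≡ true → IsQuadFace rotV u v) →
           ∀ u v → Adj graph u v → IsQuadFace rot u v
  face-4 rotV-face u v a =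
    quadFace-reflect {rotY = rotV} dec dec-injective dec-rot (rotV-face (dec u) (dec v) a)

-- The extremal quadrangulations

-- s + 1 copies of K₂,d (d = e + 2) glued along A and B: copy j has 2-side {L j, R j} and
-- d-side {A, B, C j 0, …, C j (e − 1)}.
module Spokes (s e : ℕ) where

  t d : ℕ
  t = suc s
  d = suc (suc e)

  data V : Set where
    A B : V
    L R : Fin t → V
    C : Fin t → Fin e → V

  L-injective : ∀ {i j} → L i ≡ L j → i ≡ j
  L-injective refl = refl

  R-injective : ∀ {i j} → R i ≡ R j → i ≡ j
  R-injective refl = refl

  nbr : Fin t → Fin d → V
  nbr j zero = B
  nbr j (suc zero) = A
  nbr j (suc (suc r)) = C j r

  pos : V → Fin d
  pos B = zero
  pos A = suc zero
  pos (C _ r) = suc (suc r)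
  pos (L _) = zero
  pos (R _) = zero

  pos-nbr : ∀ j k → pos (nbr j k) ≡ k
  pos-nbr j zero = refl
  pos-nbr j (suc zero) = refl
  pos-nbr j (suc (suc r)) = refl

  nbr-injective : ∀ {j k k′} → nbr j k ≡ nbr j k′ → k ≡ k′
  nbr-injective {j} {k} {k′} eq = trans (sym (pos-nbr j k)) (trans (cong pos eq) (pos-nbr j k′))

  isLR : V → Bool
  isLR (L _) = true
  isLR (R _) = true
  isLR _ = false

  isLR-nbr : ∀ j k → isLR (nbr j k) ≡ false
  isLR-nbr j zero = refl
  isLR-nbr j (suc zero) = refl
  isLR-nbr j (suc (suc r)) = refl

  nbr≢LR : ∀ j k {x} → isLR x ≡ true → nbr j k ≢ x
  nbr≢LR j k x∈LR eq = contradiction (trans (sym (isLR-nbr j k)) (trans (cong isLR eq) x∈LR)) λ ()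

  adjV : V → V → Bool
  adjV A (L _) = true
  adjV A (R _) = true
  adjV B (L _) = true
  adjV B (R _) = true
  adjV (L _) A = true
  adjV (L _) B = true
  adjV (L j) (C j′ _) = does (j ≟ j′)
  adjV (R _) A = true
  adjV (R _) B = true
  adjV (R j) (C j′ _) = does (j ≟ j′)
  adjV (C j _) (L j′) = does (j ≟ j′)
  adjV (C j _) (R j′) = does (j ≟ j′)
  adjV _ _ = false

  data Edge : V → V → Set where
    L-nbr : ∀ j k → Edge (L j) (nbr j k)
    R-nbr : ∀ j k → Edge (R j) (nbr j k)
    A-L : ∀ j → Edge A (L j)
    A-R : ∀ j → Edge A (R j)
    B-L : ∀ j → Edge B (L j)
    B-R : ∀ j → Edge B (R j)
    C-L : ∀ j r → Edge (C j r) (L j)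
    C-R : ∀ j r → Edge (C j r) (R j)

  toEdge : ∀ x y → adjV x y ≡ true → Edge x y
  toEdge A (L j) _ = A-L j
  toEdge A (R j) _ = A-R j
  toEdge B (L j) _ = B-L j
  toEdge B (R j) _ = B-R j
  toEdge (L j) A _ = L-nbr j (suc zero)
  toEdge (L j) B _ = L-nbr j zero
  toEdge (L j) (C j′ r) p with j ≟ j′ | p
  ... | yes refl | _ = L-nbr j (suc (suc r))
  ... | no _ | ()
  toEdge (R j) A _ = R-nbr j (suc zero)
  toEdge (R j) B _ = R-nbr j zero
  toEdge (R j) (C j′ r) p with j ≟ j′ | p
  ... | yes refl | _ = R-nbr j (suc (suc r))
  ... | no _ | ()
  toEdge (C j r) (L j′) p with j ≟ j′ | p
  ... | yes refl | _ = C-L j r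
  ... | no _ | ()
  toEdge (C j r) (R j′) p with j ≟ j′ | p
  ... | yes refl | _ = C-R j r
  ... | no _ | ()
  toEdge A A ()
  toEdge A B ()
  toEdge A (C _ _) ()
  toEdge B A ()
  toEdge B B ()
  toEdge B (C _ _) ()
  toEdge (L _) (L _) ()
  toEdge (L _) (R _) ()
  toEdge (R _) (L _) ()
  toEdge (R _) (R _) ()
  toEdge (C _ _) A ()
  toEdge (C _ _) B ()
  toEdge (C _ _) (C _ _) ()

  fromEdge : ∀ {x y} → Edge x y → adjV x y ≡ true
  fromEdge (L-nbr j zero) = refl
  fromEdge (L-nbr j (suc zero)) = refl
  fromEdge (L-nbr j (suc (suc r))) = dec-true (j ≟ j) refl
  fromEdge (R-nbr j zero) = refl
  fromEdge (R-nbr j (suc zero)) = refl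
  fromEdge (R-nbr j (suc (suc r))) = dec-true (j ≟ j) refl
  fromEdge (A-L j) = refl
  fromEdge (A-R j) = refl
  fromEdge (B-L j) = refl
  fromEdge (B-R j) = refl
  fromEdge (C-L j r) = dec-true (j ≟ j) refl
  fromEdge (C-R j r) = dec-true (j ≟ j) refl

  Edge-sym : ∀ {x y} → Edge x y → Edge y x
  Edge-sym (L-nbr j zero) = B-L j
  Edge-sym (L-nbr j (suc zero)) = A-L j
  Edge-sym (L-nbr j (suc (suc r))) = C-L j r
  Edge-sym (R-nbr j zero) = B-R j
  Edge-sym (R-nbr j (suc zero)) = A-R j
  Edge-sym (R-nbr j (suc (suc r))) = C-R j r
  Edge-sym (A-L j) = L-nbr j (suc zero)
  Edge-sym (A-R j) = R-nbr j (suc zero)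
  Edge-sym (B-L j) = L-nbr j zero
  Edge-sym (B-R j) = R-nbr j zero
  Edge-sym (C-L j r) = L-nbr j (suc (suc r))
  Edge-sym (C-R j r) = R-nbr j (suc (suc r))

  adjV-sym : ∀ x y → adjV x y ≡ adjV y x
  adjV-sym x y = ⇔→≡ (mk⇔ (fromEdge ∘ Edge-sym ∘ toEdge x y) (fromEdge ∘ Edge-sym ∘ toEdge y x))

  adjV-irrefl : ∀ x → adjV x x ≡ false
  adjV-irrefl A = refl
  adjV-irrefl B = refl
  adjV-irrefl (L _) = refl
  adjV-irrefl (R _) = refl
  adjV-irrefl (C _ _) = refl

  Edge-crosses : ∀ {x y} → Edge x y → 𝟙 (isLR x) + 𝟙 (isLR y) ≡ 1
  Edge-crosses (L-nbr j k) = cong (λ b → 1 + 𝟙 b) (isLR-nbr j k)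
  Edge-crosses (R-nbr j k) = cong (λ b → 1 + 𝟙 b) (isLR-nbr j k)
  Edge-crosses (A-L _) = refl
  Edge-crosses (A-R _) = refl
  Edge-crosses (B-L _) = refl
  Edge-crosses (B-R _) = refl
  Edge-crosses (C-L _ _) = refl
  Edge-crosses (C-R _ _) = refl

  -- Around L j the neighbours nbr j 0, nbr j 1, … are met in increasing order, around R j in
  -- decreasing order; around A and B the vertices L j and R j alternate.  The last clause is
  -- junk: rotV v u only matters for neighbours u of v.
  rotV : V → V → V
  rotV A (L j) = R (prev j)
  rotV A (R j) = L j
  rotV B (L j) = R j
  rotV B (R j) = L (next j)
  rotV (L j) y = nbr j (next (pos y))
  rotV (R j) y = nbr j (prev (pos y))
  rotV (C j _) (L _) = R j
  rotV (C j _) (R _) = L j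
  rotV _ y = y

  rotV-L-nbr : ∀ j k → rotV (L j) (nbr j k) ≡ nbr j (next k)
  rotV-L-nbr j k = cong (nbr j ∘ next) (pos-nbr j k)

  rotV-R-nbr : ∀ j k → rotV (R j) (nbr j k) ≡ nbr j (prev k)
  rotV-R-nbr j k = cong (nbr j ∘ prev) (pos-nbr j k)

  rotV-nbr-L : ∀ j k → k ≢ suc zero → rotV (nbr j k) (L j) ≡ R j
  rotV-nbr-L j zero _ = refl
  rotV-nbr-L j (suc zero) k≢1 = contradiction refl k≢1
  rotV-nbr-L j (suc (suc r)) _ = refl

  rotV-nbr-R : ∀ j k → k ≢ zero → rotV (nbr j k) (R j) ≡ L j
  rotV-nbr-R j zero k≢0 = contradiction refl k≢0
  rotV-nbr-R j (suc zero) _ = refl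
  rotV-nbr-R j (suc (suc r)) _ = refl

  rotV-edge : ∀ {v u} → Edge v u → Edge v (rotV v u)
  rotV-edge (L-nbr j k) = L-nbr j (next (pos (nbr j k)))
  rotV-edge (R-nbr j k) = R-nbr j (prev (pos (nbr j k)))
  rotV-edge (A-L j) = A-R (prev j)
  rotV-edge (A-R j) = A-L j
  rotV-edge (B-L j) = B-R j
  rotV-edge (B-R j) = B-L (next j)
  rotV-edge (C-L j r) = C-R j r
  rotV-edge (C-R j r) = C-L j r

  rotV-injective : ∀ {v u w} → Edge v u → Edge v w → rotV v u ≡ rotV v w → u ≡ w
  rotV-injective (L-nbr j k) (L-nbr _ k′) eq = cong (nbr j) (next-injective (nbr-injective
    (trans (sym (rotV-L-nbr j k)) (trans eq (rotV-L-nbr j k′)))))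
  rotV-injective (R-nbr j k) (R-nbr _ k′) eq = cong (nbr j) (prev-injective (nbr-injective
    (trans (sym (rotV-R-nbr j k)) (trans eq (rotV-R-nbr j k′)))))
  rotV-injective (A-L j) (A-L j′) eq = cong L (prev-injective (R-injective eq))
  rotV-injective (A-L j) (A-R j′) ()
  rotV-injective (A-R j) (A-L j′) ()
  rotV-injective (A-R j) (A-R j′) refl = refl
  rotV-injective (B-L j) (B-L j′) refl = refl
  rotV-injective (B-L j) (B-R j′) ()
  rotV-injective (B-R j) (B-L j′) ()
  rotV-injective (B-R j) (B-R j′) eq = cong R (next-injective (L-injective eq))
  rotV-injective (C-L j r) (C-L _ _) _ = refl
  rotV-injective (C-L j r) (C-R _ _) ()
  rotV-injective (C-R j r) (C-L _ _) ()
  rotV-injective (C-R j r) (C-R _ _) _ = refl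

  A-orbit : ∀ i {w} → Edge A w → ∃ λ k → iter (rotV A) k (R i) ≡ w
  A-orbit i (A-R j) = reach-twice (cyclic-along R (λ _ → refl) prev-cyclic i j)
  A-orbit i (A-L j) = let k , i↦j = reach-twice (cyclic-along R (λ _ → refl) prev-cyclic i j)
                      in suc k , cong (rotV A) i↦j

  B-orbit : ∀ i {w} → Edge B w → ∃ λ k → iter (rotV B) k (L i) ≡ w
  B-orbit i (B-L j) = reach-twice (cyclic-along L (λ _ → refl) next-cyclic i j)
  B-orbit i (B-R j) = let k , i↦j = reach-twice (cyclic-along L (λ _ → refl) next-cyclic i j)
                      in suc k , cong (rotV B) i↦j

  rotV-cyclic : ∀ {v u w} → Edge v u → Edge v w → ∃ λ k → iter (rotV v) k u ≡ w
  rotV-cyclic (L-nbr j k) (L-nbr _ k′) = cyclic-along (nbr j) (sym ∘ rotV-L-nbr j) next-cyclic k k′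
  rotV-cyclic (R-nbr j k) (R-nbr _ k′) = cyclic-along (nbr j) (sym ∘ rotV-R-nbr j) prev-cyclic k k′
  rotV-cyclic (A-R i) e = A-orbit i e
  rotV-cyclic (A-L i) e = let k , i↦w = A-orbit (prev i) e
                          in suc k , trans (iter-suc (rotV A) k (L i)) i↦w
  rotV-cyclic (B-L i) e = B-orbit i e
  rotV-cyclic (B-R i) e = let k , i↦w = B-orbit (next i) e
                          in suc k , trans (iter-suc (rotV B) k (R i)) i↦w
  rotV-cyclic (C-L j r) (C-L _ _) = 0 , refl
  rotV-cyclic (C-L j r) (C-R _ _) = 1 , refl
  rotV-cyclic (C-R j r) (C-L _ _) = 1 , refl
  rotV-cyclic (C-R j r) (C-R _ _) = 0 , refl

  -- The faces are d − 1 squares inside each copy j and one square between copies j and next j.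
  spokeFace : ∀ j k k′ → next k ≡ k′ → k ≢ zero → IsSquareFace rotV (nbr j k) (L j) (nbr j k′) (R j)
  spokeFace j k _ refl k≢0 =
      rotV-L-nbr j k
    , rotV-nbr-L j (next k) (k≢0 ∘ next-injective)
    , trans (rotV-R-nbr j (next k)) (cong (nbr j) (prev-next k))
    , rotV-nbr-R j k k≢0
    , nbr≢LR j k refl , (λ eq → next≢id k (sym (nbr-injective eq))) , nbr≢LR j k refl
    , ≢-sym (nbr≢LR j (next k) refl) , (λ ()) , nbr≢LR j (next k) refl

  poleFace : ∀ j j′ → next j ≡ j′ → IsSquareFace rotV B (L j′) A (R j)
  poleFace j _ refl =
    refl , cong R (prev-next j) , refl , refl , (λ ()) , (λ ()) , (λ ()) , (λ ()) , (λ ()) , (λ ())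

  rotV-face : ∀ {u v} → Edge u v → IsQuadFace rotV u v
  rotV-face (L-nbr j zero) = quadFace₁ rotV (spokeFace j _ zero (next-prev zero) (prev≢zero zero λ ()))
  rotV-face (L-nbr j (suc zero)) = quadFace₁ rotV (poleFace (prev j) j (next-prev j))
  rotV-face (L-nbr j k@(suc (suc _))) = quadFace₁ rotV (spokeFace j _ k (next-prev k) (prev≢zero k λ ()))
  rotV-face (R-nbr j zero) = quadFace₃ rotV (poleFace j (next j) refl)
  rotV-face (R-nbr j (suc k)) = quadFace₃ rotV (spokeFace j (suc k) _ refl λ ())
  rotV-face (A-L j) = quadFace₀ rotV (spokeFace j (suc zero) _ refl λ ())
  rotV-face (A-R j) = quadFace₂ rotV (poleFace j (next j) refl)
  rotV-face (B-L j) = quadFace₀ rotV (poleFace (prev j) j (next-prev j))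
  rotV-face (B-R j) = quadFace₂ rotV (spokeFace j _ zero (next-prev zero) (prev≢zero zero λ ()))
  rotV-face (C-L j r) = quadFace₀ rotV (spokeFace j (suc (suc r)) _ refl λ ())
  rotV-face (C-R j r) = quadFace₂ rotV (spokeFace j _ k (next-prev k) (prev≢zero k λ ()))
    where k = suc (suc r)

  n : ℕ
  n = 2 + t * d

  block : Fin t × Fin d → V
  block (j , zero) = L j
  block (j , suc zero) = R j
  block (j , suc (suc r)) = C j r

  dec : Fin n → V
  dec zero = A
  dec (suc zero) = B
  dec (suc (suc i)) = block (remQuot d i)

  enc : V → Fin n
  enc A = zero
  enc B = suc zero
  enc (L j) = suc (suc (combine j zero))
  enc (R j) = suc (suc (combine j (suc zero)))
  enc (C j r) = suc (suc (combine j (suc (suc r))))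

  dec-enc : ∀ x → dec (enc x) ≡ x
  dec-enc A = refl
  dec-enc B = refl
  dec-enc (L j) = cong block (remQuot-combine j zero)
  dec-enc (R j) = cong block (remQuot-combine j (suc zero))
  dec-enc (C j r) = cong block (remQuot-combine j (suc (suc r)))

  enc-dec : ∀ u → enc (dec u) ≡ u
  enc-dec zero = refl
  enc-dec (suc zero) = refl
  enc-dec (suc (suc i)) =
    trans (enc-block (remQuot d i)) (cong (λ i′ → suc (suc i′)) (combine-remQuot {t} d i))
    where
    enc-block : ∀ p → enc (block p) ≡ suc (suc (uncurry combine p))
    enc-block (j , zero) = refl
    enc-block (j , suc zero) = refl
    enc-block (j , suc (suc r)) = refl

  ∑V : (V → ℕ) → ℕ
  ∑V f = f A + (f B + ∑[ j < t ] (f (L j) + (f (R j) + ∑[ r < e ] f (C j r))))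

  ∑-dec : ∀ f → ∑[ u < n ] f (dec u) ≡ ∑V f
  ∑-dec f = cong (λ z → f A + (f B + z)) (trans (∑-* t (f ∘ block ∘ remQuot d))
    (sum-cong-≗ (λ j → sum-cong-≗ (λ k → cong (f ∘ block) (remQuot-combine j k)))))

  open Pullback (mk↔ₛ′ dec enc dec-enc enc-dec) adjV adjV-sym adjV-irrefl rotV public

  connected : Connected graph
  connected = connected-if-all-reach graph (enc A)
    (λ u → subst (λ w → Reach graph w (enc A)) (enc-dec u) (reaches-A (dec u)))
    where
    enc-edge : ∀ {x y} → Edge x y → Adj graph (enc x) (enc y)
    enc-edge {x} {y} e = subst₂ (λ a b → adjV a b ≡ true) (sym (dec-enc x)) (sym (dec-enc y)) (fromEdge e)
    reaches-A : ∀ x → Reach graph (enc x) (enc A)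
    reaches-A A = here
    reaches-A B = step (enc-edge (B-L zero)) (reaches-A (L zero))
    reaches-A (L j) = step (enc-edge (L-nbr j (suc zero))) here
    reaches-A (R j) = step (enc-edge (R-nbr j (suc zero))) here
    reaches-A (C j r) = step (enc-edge (C-L j r)) (reaches-A (L j))

  I : Subset n
  I = Vec.tabulate (isLR ∘ dec)

  lookup-I : ∀ u → lookup I u ≡ isLR (dec u)
  lookup-I = lookup∘tabulate (isLR ∘ dec)

  ∣I∣≡t*2 : ∣ I ∣ ≡ t * 2
  ∣I∣≡t*2 = begin
    ∣ I ∣                             ≡⟨ ∣p∣≡∑χ I ⟩
    ∑[ u < n ] χ I u                  ≡⟨ sum-cong-≗ (cong 𝟙 ∘ lookup-I) ⟩
    ∑[ u < n ] 𝟙 (isLR (dec u))       ≡⟨ ∑-dec (𝟙 ∘ isLR) ⟩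
    ∑[ j < t ] (2 + ∑[ r < e ] 0)     ≡⟨ sum-cong-≗ {t} (λ _ → cong (2 +_) (trans (∑-const e 0) (*-zeroʳ e))) ⟩
    ∑[ j < t ] 2                      ≡⟨ ∑-const t 2 ⟩
    t * 2                             ∎
    where open ≡-Reasoning

  I-side : IsBipartitionSide graph I
  I-side u v a = subst₂ (λ b c → 𝟙 b + 𝟙 c ≡ 1) (sym (lookup-I u)) (sym (lookup-I v))
                        (Edge-crosses (toEdge (dec u) (dec v) a))

  spokeDegree : ∀ j → 2 + ∑[ j′ < t ] ∑[ r < e ] 𝟙 (does (j ≟ j′)) ≡ d
  spokeDegree j = cong (2 +_) (begin
    ∑[ j′ < t ] ∑[ r < e ] 𝟙 (does (j ≟ j′))   ≡⟨ ∑-comm {t} {e} (λ j′ _ → 𝟙 (does (j ≟ j′))) ⟩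
    ∑[ r < e ] ∑[ j′ < t ] 𝟙 (does (j ≟ j′))   ≡⟨ sum-cong-≗ {e} (λ _ → ∑-δ j) ⟩
    ∑[ r < e ] 1                               ≡⟨ ∑-const e 1 ⟩
    e * 1                                      ≡⟨ *-identityʳ e ⟩
    e                                          ∎)
    where open ≡-Reasoning

  I-regular : ∀ v → v ∈ I → degree graph v ≡ d
  I-regular v v∈I = trans (trans (degree≡∑ graph v) (∑-dec (λ y → 𝟙 (adjV (dec v) y))))
                          (LR-degree (dec v) (trans (sym (lookup-I v)) ([]=⇒lookup v∈I)))
    where
    LR-degree : ∀ x → isLR x ≡ true → ∑V (λ y → 𝟙 (adjV x y)) ≡ d
    LR-degree (L j) _ = spokeDegree j
    LR-degree (R j) _ = spokeDegree j
    LR-degree A ()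
    LR-degree B ()
    LR-degree (C _ _) ()

  I-dIndependent : IsDIndependent graph d I
  I-dIndependent =
    bipartitionSide⇒independent graph {I} I-side , λ v v∈I → ≤-reflexive (sym (I-regular v v∈I))

  d*∣I∣≡2[n∸2] : d * ∣ I ∣ ≡ 2 * (n ∸ 2)
  d*∣I∣≡2[n∸2] = trans (cong (d *_) ∣I∣≡t*2) (rearrange d t)
    where
    rearrange : ∀ a b → a * (b * 2) ≡ 2 * (b * a)
    rearrange = solve-∀

  numDarts≡t*d*4 : numDarts graph ≡ t * d * 4
  numDarts≡t*d*4 = begin
    numDarts graph            ≡⟨ bipartitionSide⇒2*degreeSum≡numDarts graph {I} I-side ⟨
    2 * degreeSum graph I     ≡⟨ cong (2 *_) (regular⇒d*∣I∣≡degreeSum graph {d} {I} I-regular) ⟨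
    2 * (d * ∣ I ∣)           ≡⟨ cong (2 *_) d*∣I∣≡2[n∸2] ⟩
    2 * (2 * (t * d))         ≡⟨ rearrange (t * d) ⟩
    t * d * 4                 ∎
    where
    open ≡-Reasoning
    rearrange : ∀ m → 2 * (2 * m) ≡ m * 4
    rearrange = solve-∀

  embedding : QuadEmbedding graph
  embedding = record
    { rot = rot
    ; rot-adj = rot-adj (λ v u → fromEdge ∘ rotV-edge ∘ toEdge v u)
    ; rot-inj = rot-inj (λ v u w au aw → rotV-injective (toEdge v u au) (toEdge v w aw))
    ; rot-cyc = rot-cyc (λ v u w au aw → rotV-cyclic (toEdge v u au) (toEdge v w aw))
    ; face-4 = face-4 (λ u v → rotV-face ∘ toEdge u v)
    ; euler = subst (λ D → n + D / 4 ≡ D / 2 + 2) (sym numDarts≡t*d*4) (euler-arith (t * d))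
    }
    where
    euler-arith : ∀ m → 2 + m + m * 4 / 4 ≡ m * 4 / 2 + 2
    euler-arith m = begin
      2 + m + m * 4 / 4     ≡⟨ cong (2 + m +_) (m*n/n≡m m 4) ⟩
      2 + m + m             ≡⟨ rearrange m ⟩
      m * 2 + 2             ≡⟨ cong (_+ 2) (m*n/n≡m (m * 2) 2) ⟨
      m * 2 * 2 / 2 + 2     ≡⟨ cong (λ D → D / 2 + 2) (*-assoc m 2 2) ⟩
      m * 4 / 2 + 2         ∎
      where
      open ≡-Reasoning
      rearrange : ∀ x → 2 + x + x ≡ x * 2 + 2
      rearrange = solve-∀

spokes-extremal : ∀ e N → ∃ λ n → N ≤ n × 3 ≤ n × Σ (SimpleGraph n) λ G → PlanarQuadrangulated G
  × Σ (Subset n) λ I → IsDIndependent G (2 + e) I × (2 + e) * ∣ I ∣ ≡ 2 * (n ∸ 2)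
spokes-extremal e N =
  n , N≤n , s≤s (s≤s (s≤s z≤n)) , graph , (connected , embedding) , I , I-dIndependent , d*∣I∣≡2[n∸2]
  where
  open Spokes N e
  N≤n : N ≤ n
  N≤n = ≤-trans (n≤1+n N) (≤-trans (m≤m*n (suc N) d) (m≤n+m (t * d) 2))

theorem5p1 : (d : ℕ) → 2 ≤ d →
    ((n : ℕ) → 3 ≤ n → (G : SimpleGraph n) → PlanarQuadrangulated G →
    (I : Subset n) → IsDIndependent G d I → d * ∣ I ∣ ≤ 2 * (n ∸ 2))
    × ((N : ℕ) → ∃ λ n → N ≤ n × 3 ≤ n × Σ (SimpleGraph n) λ G → PlanarQuadrangulated G
    × Σ (Subset n) λ I → IsDIndependent G d I × d * ∣ I ∣ ≡ 2 * (n ∸ 2))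
theorem5p1 (suc (suc e)) _ =
  (λ _ _ _ (_ , Q) _ → quadrangulation⇒d*∣I∣≤2[n∸2] Q) , spokes-extremal e
theorem5p1 (suc zero) (s≤s ())
theorem5p1 zero ()
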